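{- Let $n,k,\lambda\ge 1$ be integers, and let $u,v\in\{0,1\}^n$ be $\lambda$-nonrepeating words such that $v=f_{I,T}(u)$ for some sequence of insertions and deletions $(I,T)$. If the number of $\lambda$-isolated elements of $I$ is at least $2k+1$, then $\mathrm{d}(u,v)>k$.
   Context: For $u,v\in\{0,1\}^n$, the deletion distance is $\mathrm{d}(u,v)=n-\mathrm{LCS}(u,v)$, where $\mathrm{LCS}(u,v)$ is the maximum length of a common subsequence. For an interval $J=[x,y]\subseteq[n]$, $u_J$ denotes the subword $u_xu_{x+1}\cdots u_y$. A word $u\in\{0,1\}^n$ is $\lambda$-nonrepeating if $u_J\ne u_{J'}$ for all pairs of distinct intervals $J,J'\subseteq[n]$ of length $\lambda$. For a word $u$ of length $m$, $t\in\{\mathrm{del},\mathrm{ins}0,\mathrm{ins}1\}$ and $i\in[0,m]$ (with $i\neq 0$ if $t=\mathrm{del}$), $f_{i,t}(u)$ is the word obtained from $u$ by deleting $u_i$ if $t=\mathrm{del}$, inserting a $0$ after $u_i$ if $t=\mathrm{ins}0$, and inserting a $1$ after $u_i$ if $t=\mathrm{ins}1$ (inserting after $u_0$ means inserting before $u_1$). A sequence of $\ell$ insertions and deletions is a pair $(I,T)$ where $I=(i_\ell,\dots,i_1)$ with $n\ge i_\ell\ge i_{\ell-1}\ge\cdots\ge i_1\ge 0$ and $T=(t_\ell,\dots,t_1)\in\{\mathrm{del},\mathrm{ins}0,\mathrm{ins}1\}^\ell$, such that $t_j=\mathrm{del}$ implies $i_j\neq 0$ and $i_{j-1}<i_j$;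 then $f_{I,T}(u)=(f_{i_1,t_1}\circ f_{i_2,t_2}\circ\cdots\circ f_{i_\ell,t_\ell})(u)$ for $u\in\{0,1\}^n$. An element $i$ of $I$ is $\lambda$-isolated if $\lambda<i<n-\lambda$ and no other element $j$ of $I$ satisfies $|j-i|\le 2\lambda$. -}

module Defs where

open import Data.Bool using (Bool)
open import Data.Nat using (ℕ; zero; suc; _+_; _*_; _∸_; _≤_; _<_; ∣_-_∣)
open import Data.Product using (_×_; _,_; proj₁; ∃)
open import Data.List using (List; []; _∷_; length; take; drop; foldr; map; lookup)
open import Data.List.Relation.Unary.All using (All)
open import Data.List.Relation.Unary.Linked using (Linked)
open import Data.List.Relation.Unary.Unique.Propositional using (Unique)
open import Data.List.Relation.Binary.Sublist.Propositional using (_⊆_)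
open import Data.Fin using (Fin)
open import Relation.Binary.PropositionalEquality using (_≡_; _≢_)

Word : Set
Word = List Bool

IsLCS : Word → Word → ℕ → Set
IsLCS u v m =
  (∃ λ w → (w ⊆ u) × (w ⊆ v) × (length w ≡ m)) ×
  (∀ w → w ⊆ u → w ⊆ v → length w ≤ m)

IsDelDist : ℕ → Word → Word → ℕ → Set
IsDelDist n u v d = ∃ λ m → IsLCS u v m × (d ≡ n ∸ m)

-- λ-nonrepeating: distinct length-λ intervals give distinct subwords.
-- An interval [x, x+λ-1] ⊆ [n] is encoded by its 0-based start s = x − 1, with s + λ ≤ n.
NonRepeating : ℕ → Word → Set
NonRepeating λ' u =
  ∀ s s' → s + λ' ≤ length u → s' + λ' ≤ length u → s ≢ s' →
  take λ' (drop s u) ≢ take λ' (drop s' u)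

data Op : Set where
  del ins0 ins1 : Op

-- delete the i-th letter (1-based)
deleteAt : ℕ → Word → Word
deleteAt _ [] = []
deleteAt zero w = w
deleteAt (suc zero) (x ∷ xs) = xs
deleteAt (suc (suc i)) (x ∷ xs) = x ∷ deleteAt (suc i) xs

-- insert b after the i-th letter (after u_0 = at the front)
insertAfter : ℕ → Bool → Word → Word
insertAfter zero b w = b ∷ w
insertAfter (suc i) b [] = b ∷ []
insertAfter (suc i) b (x ∷ xs) = x ∷ insertAfter i b xs

apply : ℕ → Op → Word → Word
apply i del w = deleteAt i w
apply i ins0 w = insertAfter i Bool.false w
apply i ins1 w = insertAfter i Bool.true w

-- A sequence (I,T) is represented as the list [(i_1,t_1), …, (i_ℓ,t_ℓ)].
-- f_{I,T} = f_{i_1,t_1} ∘ … ∘ f_{i_ℓ,t_ℓ}  (so (i_ℓ,t_ℓ) is applied first).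
applySeq : List (ℕ × Op) → Word → Word
applySeq ops u = foldr (λ p w → apply (proj₁ p) (Data.Product.proj₂ p) w) u ops

EntryOK : ℕ → ℕ × Op → Set
EntryOK n (i , t) = (i ≤ n) × (t ≡ del → i ≢ 0)

AdjOK : ℕ × Op → ℕ × Op → Set
AdjOK (i' , _) (i , t) = (i' ≤ i) × (t ≡ del → i' < i)

ValidSeq : ℕ → List (ℕ × Op) → Set
ValidSeq n ops = All (EntryOK n) ops × Linked AdjOK ops

Isolated : ℕ → ℕ → (I : List ℕ) → Fin (length I) → Set
Isolated λ' n I p =
  (λ' < lookup I p) × (lookup I p + λ' < n) ×
  (∀ q → q ≢ p → 2 * λ' < ∣ lookup I q - lookup I p ∣)

AtLeastIsolated : ℕ → ℕ → ℕ → List ℕ → Set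
AtLeastIsolated c λ' n I =
  ∃ λ (ps : List (Fin (length I))) →
    Unique ps × (c ≤ length ps) × All (Isolated λ' n I) ps

{-# OPTIONS --safe #-}
module Submission where

-- Around an isolated edit position i, the other edits leave the window W = u_[i-λ, i+λ]
-- untouched, so v contains W with its centre letter deleted or a letter inserted right after
-- it.  As v is λ-nonrepeating, each half of length λ of W occurs in v at most once, and the
-- changed distance between the two halves then rules out any occurrence of W itself in v.
-- The windows of distinct isolated positions are disjoint factors of u.  A common
-- subsequence w of length n - d arises from u by d deletions and gives v after d insertions,
-- and every deleted or inserted letter destroys at most one window; so with 2k + 1 windows
-- and d ≤ k some window would survive as a factor of v.

open import Defs
open import Data.Bool using (Bool)
open import Data.Fin using (zero; suc)
import Data.Fin.Properties as Fin
open import Data.List using (List; []; _∷_; _++_; [_]; length; take; drop; map; lookup)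
open import Data.List.Properties
  using ( length-++; length-++-≤ˡ; length-take; length-drop; length-map
        ; ++-assoc; ++-identityʳ; take++drop≡id; drop-drop; foldr-++)
open import Data.List.Relation.Binary.Equality.Propositional using (≋⇒≡)
open import Data.List.Relation.Binary.Permutation.Propositional as ↭ using (_↭_; ↭-sym)
open import Data.List.Relation.Binary.Permutation.Propositional.Properties using (All-resp-↭; ↭-length)
open import Data.List.Relation.Binary.Sublist.Propositional using (_⊆_; []; _∷_; _∷ʳ_; ⊆-trans)
open import Data.List.Relation.Binary.Sublist.Propositional.Properties
  using (Any-resp-⊆; length-mono-≤; to-≋)
open import Data.List.Relation.Unary.All as All using (All; []; _∷_)
open import Data.List.Relation.Unary.All.Properties using (All¬⇒¬Any; ++⁻)
import Data.List.Relation.Unary.All.Properties as All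
open import Data.List.Relation.Unary.AllPairs as AllPairs using (AllPairs; []; _∷_)
import Data.List.Relation.Unary.AllPairs.Properties as AllPairs
open import Data.List.Relation.Unary.Any using (Any; here)
open import Data.List.Relation.Unary.Linked using (Linked)
open import Data.List.Relation.Unary.Unique.Propositional using (Unique)
open import Data.List.Relation.Unary.Linked.Properties using (Linked⇒AllPairs)
import Data.List.Sort
open import Data.Nat
open import Data.Nat.Properties
open import Algebra.Properties.CommutativeSemigroup +-commutativeSemigroup using (x∙yz≈y∙xz; xy∙z≈y∙xz)
open import Data.Nat.Tactic.RingSolver using (solve-∀)
open import Data.Product using (_×_; _,_; proj₁; ∃; ∃₂)
open import Data.Vec using (Vec; toList)
open import Data.Vec.Properties using (length-toList)
open import Function using (_∘_)
open import Relation.Binary.Definitions using (Symmetric; Transitive)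
open import Relation.Binary.PropositionalEquality
  using (_≡_; _≢_; refl; sym; trans; cong; cong₂; subst; subst₂; module ≡-Reasoning)
open import Relation.Nullary using (¬_; yes; no; contradiction)
open import Relation.Nullary.Decidable using (decidable-stable)

private
  variable
    A B : Set
    P : A → Set
    R : A → A → Set
    xs ys u v w : List A
    Bs : List (List A)

-- Disjoint factors in order

Factor : List A → List A → Set
Factor w v = ∃₂ λ xs ys → v ≡ xs ++ w ++ ys

data Blocks {A : Set} : List (List A) → List A → Set where
  []   : Blocks [] u
  _∷ʳ_ : ∀ x → Blocks Bs u → Blocks Bs (x ∷ u)
  _∷_  : ∀ B → Blocks Bs u → Blocks (B ∷ Bs) (B ++ u)

Blocks-++ˡ : ∀ xs → Blocks Bs u → Blocks Bs (xs ++ u)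
Blocks-++ˡ []       blocks = blocks
Blocks-++ˡ (x ∷ xs) blocks = x ∷ʳ Blocks-++ˡ xs blocks

Blocks⇒Factor : ∀ {B} → Blocks (B ∷ Bs) u → Factor B u
Blocks⇒Factor (x ∷ʳ blocks) with Blocks⇒Factor blocks
... | xs , ys , refl = x ∷ xs , ys , refl
Blocks⇒Factor (B ∷ _) = [] , _ , refl

⊆-++-split : ∀ xs → w ⊆ xs ++ ys → ∃₂ λ w₁ w₂ → w ≡ w₁ ++ w₂ × w₁ ⊆ xs × w₂ ⊆ ys
⊆-++-split []       w⊆ys = [] , _ , refl , [] , w⊆ys
⊆-++-split (x ∷ xs) (_ ∷ʳ w⊆) with ⊆-++-split xs w⊆
... | w₁ , w₂ , refl , w₁⊆ , w₂⊆ = w₁ , w₂ , refl , x ∷ʳ w₁⊆ , w₂⊆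
⊆-++-split (x ∷ xs) (refl ∷ w⊆) with ⊆-++-split xs w⊆
... | w₁ , w₂ , refl , w₁⊆ , w₂⊆ = x ∷ w₁ , w₂ , refl , refl ∷ w₁⊆ , w₂⊆

++-⊆-split : ∀ xs → xs ++ ys ⊆ v → ∃₂ λ v₁ v₂ → v ≡ v₁ ++ v₂ × xs ⊆ v₁ × ys ⊆ v₂
++-⊆-split []       ys⊆v = [] , _ , refl , [] , ys⊆v
++-⊆-split (x ∷ xs) (y ∷ʳ ⊆v) with ++-⊆-split (x ∷ xs) ⊆v
... | v₁ , v₂ , refl , ⊆v₁ , ⊆v₂ = y ∷ v₁ , v₂ , refl , y ∷ʳ ⊆v₁ , ⊆v₂
++-⊆-split (x ∷ xs) (refl ∷ ⊆v) with ++-⊆-split xs ⊆v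
... | v₁ , v₂ , refl , ⊆v₁ , ⊆v₂ = x ∷ v₁ , v₂ , refl , refl ∷ ⊆v₁ , ⊆v₂

⊆-length-≤⇒≡ : xs ⊆ ys → length ys ≤ length xs → xs ≡ ys
⊆-length-≤⇒≡ xs⊆ys ys≤xs = ≋⇒≡ (to-≋ (≤-antisym (length-mono-≤ xs⊆ys) ys≤xs) xs⊆ys)

+-interchange-≤ : ∀ a c {b d e f} → e ≤ f → a + b ≤ c + d → a + (e + b) ≤ c + (f + d)
+-interchange-≤ a c {b} {d} {e} {f} e≤f a+b≤c+d = begin
  a + (e + b) ≡⟨ x∙yz≈y∙xz a e b ⟩
  e + (a + b) ≤⟨ +-mono-≤ e≤f a+b≤c+d ⟩
  f + (c + d) ≡⟨ x∙yz≈y∙xz f c d ⟩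
  c + (f + d) ∎
  where open ≤-Reasoning

+-interchange-< : ∀ a c {b d e f} → e < f → a + b ≤ c + d → suc (a + (e + b)) ≤ c + (f + d)
+-interchange-< a c {d = d} {f = f} e<f a+b≤c+d =
  subst (_≤ c + (f + d)) (+-suc a _) (+-interchange-≤ a c e<f a+b≤c+d)

-- Deleting a letter destroys at most one block.
Blocks-to-subsequence : Blocks Bs u → w ⊆ u →
  ∃ λ Bs′ → Bs′ ⊆ Bs × Blocks Bs′ w × length Bs + length w ≤ length Bs′ + length u
Blocks-to-subsequence [] w⊆u = [] , [] , [] , length-mono-≤ w⊆u
Blocks-to-subsequence (_ ∷ʳ blocks) (_ ∷ʳ w⊆u) with Blocks-to-subsequence blocks w⊆u
... | Bs′ , Bs′⊆ , blocks′ , bound = Bs′ , Bs′⊆ , blocks′ , ≤-trans bound (+-monoʳ-≤ _ (n≤1+n _))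
Blocks-to-subsequence (x ∷ʳ blocks) (refl ∷ w⊆u) with Blocks-to-subsequence blocks w⊆u
... | Bs′ , Bs′⊆ , blocks′ , bound = Bs′ , Bs′⊆ , x ∷ʳ blocks′ , +-interchange-≤ _ _ (s≤s z≤n) bound
Blocks-to-subsequence (_∷_ {Bs = Bs} {u = u′} B blocks) w⊆ with ⊆-++-split B w⊆
... | w₁ , w₂ , refl , w₁⊆B , w₂⊆ with Blocks-to-subsequence blocks w₂⊆ | length B ≤? length w₁
... | Bs′ , Bs′⊆ , blocks′ , bound | yes B≤w₁
  rewrite ⊆-length-≤⇒≡ w₁⊆B B≤w₁ | length-++ B {w₂} | length-++ B {u′} =
  B ∷ Bs′ , refl ∷ Bs′⊆ , B ∷ blocks′ , s≤s (+-interchange-≤ (length Bs) (length Bs′) ≤-refl bound)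
... | Bs′ , Bs′⊆ , blocks′ , bound | no B≰w₁ rewrite length-++ w₁ {w₂} | length-++ B {u′} =
  Bs′ , B ∷ʳ Bs′⊆ , Blocks-++ˡ w₁ blocks′ , +-interchange-< (length Bs) (length Bs′) (≰⇒> B≰w₁) bound

-- Inserting a letter destroys at most one block.
Blocks-to-supersequence : Blocks Bs w → w ⊆ v →
  ∃ λ Bs′ → Bs′ ⊆ Bs × Blocks Bs′ v × length Bs + length w ≤ length Bs′ + length v
Blocks-to-supersequence [] w⊆v = [] , [] , [] , length-mono-≤ w⊆v
Blocks-to-supersequence blocks@(_ ∷ʳ _) (y ∷ʳ w⊆v) with Blocks-to-supersequence blocks w⊆v
... | Bs′ , Bs′⊆ , blocks′ , bound = Bs′ , Bs′⊆ , y ∷ʳ blocks′ , ≤-trans bound (+-monoʳ-≤ _ (n≤1+n _))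
Blocks-to-supersequence (x ∷ʳ blocks) (refl ∷ w⊆v) with Blocks-to-supersequence blocks w⊆v
... | Bs′ , Bs′⊆ , blocks′ , bound = Bs′ , Bs′⊆ , x ∷ʳ blocks′ , +-interchange-≤ _ _ (s≤s z≤n) bound
Blocks-to-supersequence (_∷_ {Bs = Bs} {u = w′} B blocks) ⊆v with ++-⊆-split B ⊆v
... | v₁ , v₂ , refl , B⊆v₁ , ⊆v₂ with Blocks-to-supersequence blocks ⊆v₂ | length v₁ ≤? length B
... | Bs′ , Bs′⊆ , blocks′ , bound | yes v₁≤B
  rewrite sym (⊆-length-≤⇒≡ B⊆v₁ v₁≤B) | length-++ B {w′} | length-++ B {v₂} =
  B ∷ Bs′ , refl ∷ Bs′⊆ , B ∷ blocks′ , s≤s (+-interchange-≤ (length Bs) (length Bs′) ≤-refl bound)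
... | Bs′ , Bs′⊆ , blocks′ , bound | no v₁≰B rewrite length-++ B {w′} | length-++ v₁ {v₂} =
  Bs′ , B ∷ʳ Bs′⊆ , Blocks-++ˡ v₁ blocks′ , +-interchange-< (length Bs) (length Bs′) (≰⇒> v₁≰B) bound

Blocks-survive : Blocks Bs u → w ⊆ u → w ⊆ v →
  length u + length v < length Bs + (length w + length w) → Any (λ B → Factor B v) Bs
Blocks-survive {Bs = Bs} {u} {w} {v} blocks w⊆u w⊆v excess
  with Blocks-to-subsequence blocks w⊆u
... | Bs₁ , Bs₁⊆Bs , blocks₁ , ≤₁ with Blocks-to-supersequence blocks₁ w⊆v
... | B ∷ _ , Bs₂⊆Bs₁ , blocks₂ , _ = Any-resp-⊆ (⊆-trans Bs₂⊆Bs₁ Bs₁⊆Bs) (here (Blocks⇒Factor blocks₂))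
... | []    , _       , _       , ≤₂ = contradiction excess (≤⇒≯ (begin
  length Bs + (length w + length w) ≡⟨ +-assoc (length Bs) _ _ ⟨
  length Bs + length w + length w   ≤⟨ +-monoˡ-≤ (length w) ≤₁ ⟩
  length Bs₁ + length u + length w  ≡⟨ xy∙z≈y∙xz (length Bs₁) _ _ ⟩
  length u + (length Bs₁ + length w) ≤⟨ +-monoʳ-≤ (length u) ≤₂ ⟩
  length u + length v               ∎))
  where open ≤-Reasoning

Blocks-take-drop : ∀ ℓ (u : List A) (f : B → ℕ) {c} xs → All (λ x → c ≤ f x) xs →
  AllPairs (λ x y → f x + ℓ ≤ f y) xs → Blocks (map (λ x → take ℓ (drop (f x) u)) xs) (drop c u)
Blocks-take-drop ℓ u f [] _ _ = []
Blocks-take-drop ℓ u f {c} (x ∷ xs) (c≤x ∷ _) (x+ℓ≤xs ∷ spread) =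
  subst (Blocks _) (sym split) (Blocks-++ˡ gap (_ ∷ Blocks-take-drop ℓ u f xs x+ℓ≤xs spread))
  where
  gap = take (f x ∸ c) (drop c u)
  block = take ℓ (drop (f x) u)
  split : drop c u ≡ gap ++ block ++ drop (f x + ℓ) u
  split = begin
    drop c u                              ≡⟨ take++drop≡id (f x ∸ c) (drop c u) ⟨
    gap ++ drop (f x ∸ c) (drop c u)      ≡⟨ cong (gap ++_) (drop-drop c (f x ∸ c) u) ⟩
    gap ++ drop (c + (f x ∸ c)) u         ≡⟨ cong (λ i → gap ++ drop i u) (m+[n∸m]≡n c≤x) ⟩
    gap ++ drop (f x) u                   ≡⟨ cong (gap ++_) (take++drop≡id ℓ (drop (f x) u)) ⟨
    gap ++ block ++ drop ℓ (drop (f x) u) ≡⟨ cong (λ z → gap ++ block ++ z) (drop-drop (f x) ℓ u) ⟩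
    gap ++ block ++ drop (f x + ℓ) u      ∎
    where open ≡-Reasoning

take-length-++ : ∀ xs {ys : List A} → take (length xs) (xs ++ ys) ≡ xs
take-length-++ []       = refl
take-length-++ (x ∷ xs) = cong (x ∷_) (take-length-++ xs)

occurrence : ∀ X L {Y} {V : List A} → V ≡ X ++ L ++ Y →
  length X + length L ≤ length V × take (length L) (drop (length X) V) ≡ L
occurrence [] L {Y} refl = ≤-trans (m≤m+n _ _) (≤-reflexive (sym (length-++ L))) , take-length-++ L
occurrence (x ∷ X) L refl with occurrence X L refl
... | fits , occ = s≤s fits , occ

occurrence-unique : ∀ {λ' Y Y′} {V : Word} → NonRepeating λ' V → ∀ X L X′ → length L ≡ λ' →
  V ≡ X ++ L ++ Y → V ≡ X′ ++ L ++ Y′ → length X ≡ length X′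
occurrence-unique nr X L X′ refl V≡ V≡′ with occurrence X L V≡ | occurrence X′ L V≡′
... | fits , occ | fits′ , occ′ =
  decidable-stable (_ ≟ _) λ X≢X′ → nr _ _ fits fits′ X≢X′ (trans occ (sym occ′))

occurrence-gap : ∀ {λ' Y Y′} {V : Word} → NonRepeating λ' V →
  ∀ X L G R X′ G′ → length L ≡ λ' → length R ≡ λ' →
  V ≡ X ++ L ++ G ++ R ++ Y → V ≡ X′ ++ L ++ G′ ++ R ++ Y′ → length G ≡ length G′
occurrence-gap {Y = Y} {Y′} {V} nr X L G R X′ G′ |L| |R| V≡ V≡′ =
  +-cancelˡ-≡ (length L) _ _ (+-cancelˡ-≡ (length X) _ _ (begin
    length X + (length L + length G)   ≡⟨ length-++₃ X L G ⟨
    length (X ++ L ++ G)               ≡⟨ occurrence-unique nr (X ++ L ++ G) R (X′ ++ L ++ G′) |R|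
                                            (regroup X G Y V≡) (regroup X′ G′ Y′ V≡′) ⟩
    length (X′ ++ L ++ G′)             ≡⟨ length-++₃ X′ L G′ ⟩
    length X′ + (length L + length G′) ≡⟨ cong (_+ _) X≡X′ ⟨
    length X + (length L + length G′)  ∎))
  where
  open ≡-Reasoning
  X≡X′ = occurrence-unique nr X L X′ |L| V≡ V≡′
  length-++₃ : ∀ X L (G : Word) → length (X ++ L ++ G) ≡ length X + (length L + length G)
  length-++₃ X L G = trans (length-++ X) (cong (length X +_) (length-++ L))
  regroup : ∀ X G Y → V ≡ X ++ L ++ G ++ R ++ Y → V ≡ (X ++ L ++ G) ++ R ++ Y
  regroup X G Y V≡ =
    trans V≡ (sym (trans (++-assoc X (L ++ G) (R ++ Y)) (cong (X ++_) (++-assoc L G (R ++ Y)))))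

apply-∷ : ∀ {j} t x (w : Word) → (t ≡ del → 0 < j) → apply (suc j) t (x ∷ w) ≡ x ∷ apply j t w
apply-∷ {zero}  del  x w 0<0 = contradiction (0<0 refl) (<-irrefl refl)
apply-∷ {suc j} del  x w _   = refl
apply-∷         ins0 x w _   = refl
apply-∷         ins1 x w _   = refl

apply-++ˡ : ∀ p {w : Word} j t → (t ≡ del → 0 < j) → apply (length p + j) t (p ++ w) ≡ p ++ apply j t w
apply-++ˡ []      j t _       = refl
apply-++ˡ (x ∷ p) j t del⇒0<j =
  trans (apply-∷ t x _ λ t≡del → <-≤-trans (del⇒0<j t≡del) (m≤n+m j _))
        (cong (x ∷_) (apply-++ˡ p j t del⇒0<j))

apply-++ʳ : ∀ (w : Word) {r} j t → j ≤ length w → (t ≡ del → 0 < j) →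
  apply j t (w ++ r) ≡ apply j t w ++ r
apply-++ʳ w       zero          del  _        0<0 = contradiction (0<0 refl) (<-irrefl refl)
apply-++ʳ w       zero          ins0 _        _   = refl
apply-++ʳ w       zero          ins1 _        _   = refl
apply-++ʳ (x ∷ w) (suc zero)    del  _        _   = refl
apply-++ʳ (x ∷ w) (suc (suc j)) del  (s≤s j≤) _   = cong (x ∷_) (apply-++ʳ w (suc j) del j≤ λ _ → s≤s z≤n)
apply-++ʳ (x ∷ w) (suc j)       ins0 (s≤s j≤) _   = cong (x ∷_) (apply-++ʳ w j ins0 j≤ λ ())
apply-++ʳ (x ∷ w) (suc j)       ins1 (s≤s j≤) _   = cong (x ∷_) (apply-++ʳ w j ins1 j≤ λ ())

apply-local : ∀ p m z {j t} → length p ≤ j → j ≤ length (p ++ m) → (t ≡ del → length p < j) →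
  apply j t (p ++ m ++ z) ≡ p ++ apply (j ∸ length p) t m ++ z
apply-local p m z {j} {t} p≤j j≤ del⇒p<j = begin
  apply j t (p ++ m ++ z)                           ≡⟨ cong (λ i → apply i t _) (m+[n∸m]≡n p≤j) ⟨
  apply (length p + (j ∸ length p)) t (p ++ m ++ z) ≡⟨ apply-++ˡ p _ t del⇒0<k ⟩
  p ++ apply (j ∸ length p) t (m ++ z)              ≡⟨ cong (p ++_) (apply-++ʳ m _ t k≤m del⇒0<k) ⟩
  p ++ apply (j ∸ length p) t m ++ z                ∎
  where
  open ≡-Reasoning
  k≤m : j ∸ length p ≤ length m
  k≤m = m≤n+o⇒m∸n≤o j _ (subst (j ≤_) (length-++ p) j≤)
  del⇒0<k : t ≡ del → 0 < j ∸ length p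
  del⇒0<k = m<n⇒0<n∸m ∘ del⇒p<j

applySeq-++ : ∀ ops ops′ (u : Word) → applySeq (ops ++ ops′) u ≡ applySeq ops (applySeq ops′ u)
applySeq-++ ops ops′ u = foldr-++ _ u ops ops′

AdjOK-trans : Transitive AdjOK
AdjOK-trans {_ , _} {_ , _} {_ , _} (i≤j , _) (j≤k , del⇒j<k) = ≤-trans i≤j j≤k , ≤-<-trans i≤j ∘ del⇒j<k

AdjOK-Linked⇒AllPairs : ∀ {ops} → Linked AdjOK ops → AllPairs AdjOK ops
AdjOK-Linked⇒AllPairs = Linked⇒AllPairs (λ {x} {y} {z} → AdjOK-trans {x} {y} {z})

split-at : ∀ (p m : List A) {j} → length p ≤ j → j ≤ length (p ++ m) →
  ∃₂ λ q r → m ≡ q ++ r × length (p ++ q) ≡ j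
split-at [] m {j} _ j≤m =
  take j m , drop j m , sym (take++drop≡id j m) , trans (length-take j m) (m≤n⇒m⊓n≡m j≤m)
split-at (x ∷ p) m (s≤s p≤j) (s≤s j≤pm) with split-at p m p≤j j≤pm
... | q , r , m≡qr , |pq| = q , r , m≡qr , cong suc |pq|

++-regroup : ∀ (xs ys zs ws : List A) → xs ++ (ys ++ zs) ++ ws ≡ (xs ++ ys) ++ zs ++ ws
++-regroup xs ys zs ws = trans (cong (xs ++_) (++-assoc ys zs ws)) (sym (++-assoc xs ys (zs ++ ws)))

Within : ℕ → ℕ → ℕ × Op → Set
Within lo hi (j , t) = lo ≤ j × j ≤ hi × (t ≡ del → lo < j)

Within-narrow : ∀ {j t lo hi ops} → All (AdjOK (j , t)) ops → All (Within lo hi) ops →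
  All (Within j hi) ops
Within-narrow j≤ops within =
  All.zipWith (λ { {_ , _} ((j≤ , del⇒j<) , (_ , ≤hi , _)) → j≤ , ≤hi , del⇒j< }) (j≤ops , within)

-- The tail of ops, at positions ≥ j, acts first and leaves the first j letters alone, so the
-- head edit at j still lands inside the middle part.
applySeq-local : ∀ ops p m (z : Word) {lo hi} → length p ≡ lo → length (p ++ m) ≡ hi →
  AllPairs AdjOK ops → All (Within lo hi) ops → ∃ λ m′ → applySeq ops (p ++ m ++ z) ≡ p ++ m′ ++ z
applySeq-local [] p m z _ _ _ _ = m , refl
applySeq-local ((j , t) ∷ ops) p m z refl refl (j≤ops ∷ sorted) ((p≤j , j≤pm , del⇒p<j) ∷ within)
  with split-at p m p≤j j≤pm
... | q , r , refl , refl
  with applySeq-local ops (p ++ q) r z refl (cong length (++-assoc p q r)) sorted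
                      (Within-narrow {t = t} j≤ops within)
... | r′ , ops-local = apply (length (p ++ q) ∸ length p) t (q ++ r′) , (begin
  apply j t (applySeq ops (p ++ (q ++ r) ++ z)) ≡⟨ cong (apply j t ∘ applySeq ops) (++-regroup p q r z) ⟩
  apply j t (applySeq ops ((p ++ q) ++ r ++ z)) ≡⟨ cong (apply j t) ops-local ⟩
  apply j t ((p ++ q) ++ r′ ++ z)               ≡⟨ cong (apply j t) (++-regroup p q r′ z) ⟨
  apply j t (p ++ (q ++ r′) ++ z)               ≡⟨ apply-local p (q ++ r′) z p≤j j≤pqr′ del⇒p<j ⟩
  p ++ apply (j ∸ length p) t (q ++ r′) ++ z    ∎)
  where
  open ≡-Reasoning
  j≤pqr′ : j ≤ length (p ++ q ++ r′)
  j≤pqr′ = subst (j ≤_) (cong length (++-assoc p q r′)) (length-++-≤ˡ (p ++ q))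

applySeq-around : ∀ {opsˡ i t opsʳ j lo mid hi} P M Z →
  length P ≡ lo → length (P ++ M) ≡ mid → length ((P ++ M) ++ Z) ≡ hi →
  AllPairs AdjOK opsˡ → AllPairs AdjOK opsʳ → All (Within 0 lo) opsˡ → All (Within mid hi) opsʳ →
  length P + j ≡ i → j ≤ length M → (t ≡ del → 0 < j) →
  ∃₂ λ P′ Z′ → applySeq (opsˡ ++ (i , t) ∷ opsʳ) (P ++ M ++ Z) ≡ P′ ++ apply j t M ++ Z′
applySeq-around {opsˡ} {i} {t} {opsʳ} {j} P M Z |P| |PM| |PMZ| sortedˡ sortedʳ withinˡ withinʳ
                refl j≤M del⇒0<j
  with applySeq-local opsʳ (P ++ M) Z [] |PM| |PMZ| sortedʳ withinʳ
... | Z′ , right-local with applySeq-local opsˡ [] P (apply j t M ++ Z′) refl |P| sortedˡ withinˡ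
... | P′ , left-local = P′ , Z′ , (begin
  applySeq (opsˡ ++ (i , t) ∷ opsʳ) (P ++ M ++ Z)          ≡⟨ applySeq-++ opsˡ _ _ ⟩
  applySeq opsˡ (apply i t (applySeq opsʳ (P ++ M ++ Z)))  ≡⟨ cong (applySeq opsˡ ∘ apply i t) right ⟩
  applySeq opsˡ (apply i t (P ++ M ++ Z′))
    ≡⟨ cong (applySeq opsˡ) (apply-++ˡ P j t del⇒0<j) ⟩
  applySeq opsˡ (P ++ apply j t (M ++ Z′))
    ≡⟨ cong (applySeq opsˡ ∘ (P ++_)) (apply-++ʳ M j t j≤M del⇒0<j) ⟩
  applySeq opsˡ (P ++ apply j t M ++ Z′)                   ≡⟨ left-local ⟩
  P′ ++ apply j t M ++ Z′                                  ∎)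
  where
  open ≡-Reasoning
  right : applySeq opsʳ (P ++ M ++ Z) ≡ P ++ M ++ Z′
  right = begin
    applySeq opsʳ (P ++ M ++ Z)             ≡⟨ cong (applySeq opsʳ ∘ (P ++_) ∘ (M ++_)) (++-identityʳ Z) ⟨
    applySeq opsʳ (P ++ M ++ Z ++ [])       ≡⟨ cong (applySeq opsʳ) (++-assoc P M (Z ++ [])) ⟨
    applySeq opsʳ ((P ++ M) ++ Z ++ [])     ≡⟨ right-local ⟩
    (P ++ M) ++ Z′ ++ []                    ≡⟨ ++-assoc P M (Z′ ++ []) ⟩
    P ++ M ++ Z′ ++ []                      ≡⟨ cong ((P ++_) ∘ (M ++_)) (++-identityʳ Z′) ⟩
    P ++ M ++ Z′                            ∎

-- The paper's u_{[i-λ, i+λ]}: positions are 1-based, so the window starts at index i ∸ suc λ'.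
window : ℕ → Word → ℕ → Word
window λ' u i = take (suc (2 * λ')) (drop (i ∸ suc λ') u)

suc-2*≡+suc : ∀ n → suc (2 * n) ≡ n + suc n
suc-2*≡+suc = solve-∀

window-end : ∀ {λ' i} → λ' < i → i ∸ suc λ' + suc (2 * λ') ≡ i + λ'
window-end {λ'} {i} λ'<i = begin
  i ∸ suc λ' + suc (2 * λ')  ≡⟨ cong (i ∸ suc λ' +_) (trans (suc-2*≡+suc λ') (+-comm λ' _)) ⟩
  i ∸ suc λ' + (suc λ' + λ') ≡⟨ +-assoc (i ∸ suc λ') _ _ ⟨
  i ∸ suc λ' + suc λ' + λ'   ≡⟨ cong (_+ λ') (m∸n+n≡m λ'<i) ⟩
  i + λ'                     ∎
  where open ≡-Reasoning

window-split : ∀ λ' (u : Word) i → λ' < i → i + λ' ≤ length u →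
  ∃₂ λ P Z → u ≡ P ++ window λ' u i ++ Z × length P ≡ i ∸ suc λ' × length (window λ' u i) ≡ suc (2 * λ')
window-split λ' u i λ'<i i+λ'≤u =
  take c u , drop ℓ (drop c u) ,
  sym (trans (cong (take c u ++_) (take++drop≡id ℓ (drop c u))) (take++drop≡id c u)) ,
  trans (length-take c u) (m≤n⇒m⊓n≡m (≤-trans (m≤m+n c ℓ) c+ℓ≤u)) ,
  trans (length-take ℓ (drop c u))
        (m≤n⇒m⊓n≡m (subst (ℓ ≤_) (sym (length-drop c u))
                              (m+n≤o⇒m≤o∸n ℓ (subst (_≤ length u) (+-comm c ℓ) c+ℓ≤u))))
  where
  c = i ∸ suc λ'
  ℓ = suc (2 * λ')
  c+ℓ≤u : c + ℓ ≤ length u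
  c+ℓ≤u = subst (_≤ length u) (sym (window-end λ'<i)) i+λ'≤u

split-length : ∀ k (m : List A) {l} → length m ≡ k + l →
  ∃₂ λ q r → m ≡ q ++ r × length q ≡ k × length r ≡ l
split-length zero    m       |m| = [] , m , refl , refl , |m|
split-length (suc k) (x ∷ m) |m| with split-length k m (suc-injective |m|)
... | q , r , refl , |q| , |r| = x ∷ q , r , refl , cong suc |q| , |r|

deleteAt-++ : ∀ L {x : Bool} {R} → deleteAt (suc (length L)) (L ++ x ∷ R) ≡ L ++ R
deleteAt-++ []      = refl
deleteAt-++ (y ∷ L) = cong (y ∷_) (deleteAt-++ L)

insertAfter-++ : ∀ L {b : Bool} {R} → insertAfter (length L) b (L ++ R) ≡ L ++ b ∷ R
insertAfter-++ []      = refl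
insertAfter-++ (y ∷ L) = cong (y ∷_) (insertAfter-++ L)

-- Deleting the centre x of W = L x R leaves L R in V; an occurrence of W in V would put the
-- halves L and R, which occur only once, at distance 1 as well.
centre-deletion-not-factor : ∀ {λ' P M Z} {V : Word} → NonRepeating λ' V → length M ≡ suc (2 * λ') →
  V ≡ P ++ deleteAt (suc λ') M ++ Z → ¬ Factor M V
centre-deletion-not-factor {λ'} {P} {M} {Z} nr |M| V≡ (X , Y , V≡XMY)
  with split-length λ' M (trans |M| (suc-2*≡+suc λ'))
... | L , x ∷ R , refl , refl , |xR| = contradiction gaps λ ()
  where
  |R| = suc-injective |xR|
  gaps : 1 ≡ 0
  gaps = occurrence-gap nr X L [ x ] R P [] refl |R|
    (trans V≡XMY (cong (X ++_) (++-assoc L (x ∷ R) Y)))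
    (trans V≡ (trans (cong (λ W → P ++ W ++ Z) (deleteAt-++ L)) (cong (P ++_) (++-assoc L R Z))))

-- Inserting b after the centre of W = a L R (the last letter of a L) leaves a L b R in V; an
-- occurrence of W in V would put the halves L and R, which occur only once, at distance 0 too.
centre-insertion-not-factor : ∀ {λ' P M Z b} {V : Word} → NonRepeating λ' V → length M ≡ suc (2 * λ') →
  V ≡ P ++ insertAfter (suc λ') b M ++ Z → ¬ Factor M V
centre-insertion-not-factor {λ'} {P} {a ∷ M} {Z} {b} nr |M| V≡ (X , Y , V≡XMY)
  with split-length λ' M (trans (suc-injective |M|) (cong (λ' +_) (+-identityʳ λ')))
... | L , R , refl , refl , |R| = contradiction gaps λ ()
  where
  gaps : 0 ≡ 1
  gaps = occurrence-gap nr (X ++ [ a ]) L [] R (P ++ [ a ]) [ b ] refl |R|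
    (trans V≡XMY (trans (cong (λ W → X ++ a ∷ W) (++-assoc L R Y)) (sym (++-assoc X [ a ] _))))
    (trans V≡ (trans (cong (λ W → P ++ a ∷ W ++ Z) (insertAfter-++ L))
                     (trans (cong (λ W → P ++ a ∷ W) (++-assoc L (b ∷ R) Z)) (sym (++-assoc P [ a ] _)))))

centre-edit-not-factor : ∀ {λ' t P M Z} {V : Word} → NonRepeating λ' V → length M ≡ suc (2 * λ') →
  V ≡ P ++ apply (suc λ') t M ++ Z → ¬ Factor M V
centre-edit-not-factor {t = del}  {P} {Z = Z} = centre-deletion-not-factor {P = P} {Z = Z}
centre-edit-not-factor {t = ins0} {P} {Z = Z} = centre-insertion-not-factor {P = P} {Z = Z}
centre-edit-not-factor {t = ins1} {P} {Z = Z} = centre-insertion-not-factor {P = P} {Z = Z}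

<∣-∣⇒+< : ∀ {m n d} → m ≤ n → d < ∣ m - n ∣ → m + d < n
<∣-∣⇒+< {m} m≤n d< =
  subst (m + _ <_) (m+[n∸m]≡n m≤n) (+-monoʳ-< m (subst (_ <_) (m≤n⇒∣m-n∣≡n∸m m≤n) d<))

AllPairs-++⁻ : ∀ xs {ys} → AllPairs R (xs ++ ys) →
  AllPairs R xs × All (λ x → All (R x) ys) xs × AllPairs R ys
AllPairs-++⁻ []       pairs        = [] , [] , pairs
AllPairs-++⁻ (x ∷ xs) (x~ ∷ pairs) with AllPairs-++⁻ xs pairs | ++⁻ xs x~
... | pairsˡ , across , pairsʳ | x~xs , x~ys = x~xs ∷ pairsˡ , x~ys ∷ across , pairsʳ

split-at-lookup : ∀ (xs : List (A × B)) q → (∀ q′ → q′ ≢ q → P (lookup (map proj₁ xs) q′)) →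
  ∃ λ ys → ∃ λ b → ∃ λ zs →
    xs ≡ ys ++ (lookup (map proj₁ xs) q , b) ∷ zs × All (P ∘ proj₁) ys × All (P ∘ proj₁) zs
split-at-lookup {A = A} {B = B} {P = P} ((a , b) ∷ xs) zero others =
  [] , b , xs , refl , [] , all xs (λ q → others (suc q) λ ())
  where
  all : ∀ (xs : List (A × B)) → (∀ q → P (lookup (map proj₁ xs) q)) → All (P ∘ proj₁) xs
  all []       _ = []
  all (x ∷ xs) p = p zero ∷ all xs (p ∘ suc)
split-at-lookup (x ∷ xs) (suc q) others
  with split-at-lookup xs q (λ q′ q′≢q → others (suc q′) (q′≢q ∘ Fin.suc-injective))
... | ys , b , zs , xs≡ , ys-far , zs-far =
  x ∷ ys , b , zs , cong (x ∷_) xs≡ , others zero (λ ()) ∷ ys-far , zs-far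

edits-before : ∀ {λ' n i t} ops → All (λ e → AdjOK e (i , t)) ops →
  All (λ e → 2 * λ' < ∣ proj₁ e - i ∣) ops → All (EntryOK n) ops → All (Within 0 (i ∸ suc λ')) ops
edits-before [] [] [] [] = []
edits-before {λ'} {i = i} ((a , _) ∷ ops) ((a≤i , _) ∷ ≤i) (far ∷ fars) ((_ , del⇒a≢0) ∷ entries) =
  (z≤n , a≤ , n≢0⇒n>0 ∘ del⇒a≢0) ∷ edits-before ops ≤i fars entries
  where
  a≤ : a ≤ i ∸ suc λ'
  a≤ = m+n≤o⇒m≤o∸n a (≤-trans (+-monoʳ-≤ a (s≤s (m≤m+n λ' _)))
                               (subst (_≤ i) (sym (+-suc a _)) (<∣-∣⇒+< a≤i far)))

edits-after : ∀ {λ' n i t} ops → All (AdjOK (i , t)) ops →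
  All (λ e → 2 * λ' < ∣ proj₁ e - i ∣) ops → All (EntryOK n) ops → All (Within (i + λ') n) ops
edits-after [] [] [] [] = []
edits-after {λ'} {n} {i} {t} ((b , _) ∷ ops) ((i≤b , _) ∷ i≤) (far ∷ fars) ((b≤n , _) ∷ entries) =
  (<⇒≤ i+λ'<b , b≤n , λ _ → i+λ'<b) ∷ edits-after {λ'} {n} {i} {t} ops i≤ fars entries
  where
  i+λ'<b : i + λ' < b
  i+λ'<b = ≤-<-trans (+-monoʳ-≤ i (m≤m+n λ' _)) (<∣-∣⇒+< i≤b (subst (_ <_) (∣-∣-comm b i) far))

-- The other edits stay clear of the window around i, so v contains that window with only its
-- centre edited.
window-not-factor : ∀ {λ' n opsˡ i t opsʳ} {u v : Word} → NonRepeating λ' v → length u ≡ n →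
  ValidSeq n (opsˡ ++ (i , t) ∷ opsʳ) → v ≡ applySeq (opsˡ ++ (i , t) ∷ opsʳ) u → λ' < i → i + λ' < n →
  All (λ e → 2 * λ' < ∣ proj₁ e - i ∣) opsˡ → All (λ e → 2 * λ' < ∣ proj₁ e - i ∣) opsʳ →
  ¬ Factor (window λ' u i) v
window-not-factor {λ'} {opsˡ = opsˡ} {i} {t} {opsʳ} {u} nr refl (entries , linked) v≡ λ'<i i+λ'<n farˡ farʳ
  with window-split λ' u i λ'<i (<⇒≤ i+λ'<n)
     | AllPairs-++⁻ opsˡ (AdjOK-Linked⇒AllPairs linked) | ++⁻ opsˡ entries
... | P , Z , u≡ , |P| , |M| | sortedˡ , before , i≤ʳ ∷ sortedʳ | entriesˡ , _ ∷ entriesʳ =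
  let P′ , Z′ , around = applySeq-around {t = t} P M Z |P| |PM| |PMZ| sortedˡ sortedʳ
                           (edits-before {λ'} {length u} {i} {t} opsˡ (All.map All.head before)
                                         farˡ entriesˡ)
                           (edits-after {λ'} {length u} {i} {t} opsʳ i≤ʳ farʳ entriesʳ)
                           (trans (cong (_+ suc λ') |P|) (m∸n+n≡m λ'<i))
                           (subst (suc λ' ≤_) (sym |M|) (s≤s (m≤m+n λ' _)))
                           (λ _ → s≤s z≤n)
  in centre-edit-not-factor {t = t} {P′} {Z = Z′} nr |M|
       (trans v≡ (trans (cong (applySeq (opsˡ ++ (i , t) ∷ opsʳ)) u≡) around))
  where
  M = window λ' u i
  |PM| : length (P ++ M) ≡ i + λ'
  |PM| = trans (length-++ P) (trans (cong₂ _+_ |P| |M|) (window-end λ'<i))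
  |PMZ| : length ((P ++ M) ++ Z) ≡ length u
  |PMZ| = cong length (trans (++-assoc P M Z) (sym u≡))

isolated-window-not-factor : ∀ {λ' n ops} {u v : Word} → NonRepeating λ' v → length u ≡ n →
  ValidSeq n ops → v ≡ applySeq ops u →
  ∀ q → Isolated λ' n (map proj₁ ops) q → ¬ Factor (window λ' u (lookup (map proj₁ ops) q)) v
isolated-window-not-factor {n = n} {ops} {u} {v} nr |u| valid v≡ q (λ'<i , i+λ'<n , far)
  with split-at-lookup ops q far
... | opsˡ , t , opsʳ , ops≡ , farˡ , farʳ =
  window-not-factor nr |u| (subst (ValidSeq n) ops≡ valid) (subst (λ ops → v ≡ applySeq ops u) ops≡ v≡)
                    λ'<i i+λ'<n farˡ farʳ

-- Isolated edits have disjoint windows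

AllPairs-resp-↭ : Symmetric R → AllPairs R xs → xs ↭ ys → AllPairs R ys
AllPairs-resp-↭ sym pairs ↭.refl = pairs
AllPairs-resp-↭ sym (x~ ∷ pairs) (↭.prep x xs↭ys) = All-resp-↭ xs↭ys x~ ∷ AllPairs-resp-↭ sym pairs xs↭ys
AllPairs-resp-↭ sym ((x~y ∷ x~) ∷ y~ ∷ pairs) (↭.swap x y xs↭ys) =
  (sym x~y ∷ All-resp-↭ xs↭ys y~) ∷ All-resp-↭ xs↭ys x~ ∷ AllPairs-resp-↭ sym pairs xs↭ys
AllPairs-resp-↭ sym pairs (↭.trans xs↭ys ys↭zs) =
  AllPairs-resp-↭ sym (AllPairs-resp-↭ sym pairs xs↭ys) ys↭zs

Apart : ℕ → ℕ → ℕ → Set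
Apart λ' i j = λ' < i × λ' < j × 2 * λ' < ∣ i - j ∣

Apart-sym : ∀ {λ'} → Symmetric (Apart λ')
Apart-sym {x = i} {j} (λ'<i , λ'<j , far) = λ'<j , λ'<i , subst (_ <_) (∣-∣-comm i j) far

Apart⇒windows-disjoint : ∀ {λ' i j} → Apart λ' i j → i ≤ j → i ∸ suc λ' + suc (2 * λ') ≤ j ∸ suc λ'
Apart⇒windows-disjoint {λ'} {i} {j} (λ'<i , _ , far) i≤j =
  subst (_≤ j ∸ suc λ') (sym (window-end λ'<i)) (m+n≤o⇒m≤o∸n (i + λ') (begin
    i + λ' + suc λ'    ≡⟨ +-assoc i λ' _ ⟩
    i + (λ' + suc λ')  ≡⟨ cong (i +_) (suc-2*≡+suc λ') ⟨
    i + suc (2 * λ')   ≡⟨ +-suc i _ ⟩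
    suc (i + 2 * λ')   ≤⟨ <∣-∣⇒+< i≤j far ⟩
    j                  ∎))
  where open ≤-Reasoning

windows-Blocks : ∀ λ' (u : Word) {cs} → Linked _≤_ cs → AllPairs (Apart λ') cs →
  Blocks (map (window λ' u) cs) u
windows-Blocks λ' u sorted apart =
  Blocks-take-drop (suc (2 * λ')) u (_∸ suc λ') _ (All.universal (λ _ → z≤n) _)
    (AllPairs.zipWith (λ (i≤j , i-j-apart) → Apart⇒windows-disjoint i-j-apart i≤j)
                      (Linked⇒AllPairs ≤-trans sorted , apart))

isolated-Apart : ∀ {λ' n} {I : List ℕ} {qs} → Unique qs → All (Isolated λ' n I) qs →
  AllPairs (λ q q′ → Apart λ' (lookup I q) (lookup I q′)) qs
isolated-Apart []               []                          = []
isolated-Apart {I = I} (q∉qs ∷ unique) ((λ'<i , _) ∷ isolated) =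
  All.zipWith (λ { (q≢q′ , (λ'<j , _ , far)) → λ'<i , λ'<j , far _ q≢q′ }) (q∉qs , isolated)
  ∷ isolated-Apart {I = I} unique isolated

isolated-windows : ∀ {λ' n ops c} {u v : Word} → NonRepeating λ' v → length u ≡ n → ValidSeq n ops →
  v ≡ applySeq ops u → AtLeastIsolated c λ' n (map proj₁ ops) →
  ∃ λ Ws → c ≤ length Ws × Blocks Ws u × All (λ W → ¬ Factor W v) Ws
isolated-windows {λ'} {ops = ops} {c} {u} nr |u| valid v≡ (ps , unique , count , isolated) =
  windows , count′ , blocks , not-factors
  where
  open Data.List.Sort ≤-decTotalOrder using (sort; sort-↭; sort-↗)
  I = map proj₁ ops
  centres = sort (map (lookup I) ps)
  centres↭ : map (lookup I) ps ↭ centres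
  centres↭ = ↭-sym (sort-↭ _)
  windows = map (window λ' u) centres
  count′ : c ≤ length windows
  count′ = ≤-trans count (≤-reflexive (begin
    length ps                  ≡⟨ length-map (lookup I) ps ⟨
    length (map (lookup I) ps) ≡⟨ ↭-length centres↭ ⟩
    length centres             ≡⟨ length-map (window λ' u) centres ⟨
    length windows             ∎))
    where open ≡-Reasoning
  blocks : Blocks windows u
  blocks = windows-Blocks λ' u (sort-↗ _)
             (AllPairs-resp-↭ Apart-sym (AllPairs.map⁺ (isolated-Apart {I = I} unique isolated)) centres↭)
  not-factors : All (λ W → ¬ Factor W _) windows
  not-factors = All.map⁺ (All-resp-↭ centres↭ (All.map⁺
    (All.map (λ {q} → isolated-window-not-factor nr |u| valid v≡ q) isolated)))

deficit-bound : ∀ {n m k b} → n ∸ m ≤ k → 2 * k + 1 ≤ b → n + n < b + (m + m)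
deficit-bound {n} {m} {k} {b} n∸m≤k 2k+1≤b = begin-strict
  n + n                 ≤⟨ +-mono-≤ n≤m+k n≤m+k ⟩
  (m + k) + (m + k)     <⟨ ≤-reflexive (regroup m k) ⟩
  (2 * k + 1) + (m + m) ≤⟨ +-monoˡ-≤ (m + m) 2k+1≤b ⟩
  b + (m + m)           ∎
  where
  open ≤-Reasoning
  n≤m+k : n ≤ m + k
  n≤m+k = ≤-trans (m≤n+m∸n n m) (+-monoʳ-≤ m n∸m≤k)
  regroup : ∀ m k → suc ((m + k) + (m + k)) ≡ (2 * k + 1) + (m + m)
  regroup = solve-∀

lemma2p3 : (n k λ' : ℕ) → 1 ≤ n → 1 ≤ k → 1 ≤ λ' →
    (u v : Vec Bool n) →
    NonRepeating λ' (toList u) → NonRepeating λ' (toList v) →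
    (ops : List (ℕ × Op)) → ValidSeq n ops →
    toList v ≡ applySeq ops (toList u) →
    AtLeastIsolated (2 * k + 1) λ' n (map proj₁ ops) →
    ∀ d → IsDelDist n (toList u) (toList v) d → k < d
lemma2p3 n k λ' _ _ _ u v _ nr-v ops valid v≡ isolated _ (_ , ((w , w⊆u , w⊆v , refl) , _) , refl)
  with isolated-windows nr-v (length-toList u) valid v≡ isolated
... | Ws , count , blocks , not-factors = ≰⇒> λ n∸w≤k →
  All¬⇒¬Any not-factors (Blocks-survive blocks w⊆u w⊆v
    (subst₂ (λ a b → a + b < length Ws + (length w + length w))
            (sym (length-toList u)) (sym (length-toList v)) (deficit-bound {n} {length w} n∸w≤k count)))
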